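{- Let $b\in{}^\omega(\omega+1\setminus2)$ and let $R$ be a relation sequence for $b$. Then $\mathbf E^{\mathrm{cp}}_{b,R}\preceq_{\mathrm T}\mathbf E^{\mathrm{pr}}_{b,R}$. Consequently $\mathfrak e^{\forall}_{b,R}\le\mathfrak e^{\mathsf{const}}_{b,R}$ and $\mathfrak v^{\mathsf{const}}_{b,R}\le\mathfrak v^{\forall}_{b,R}$.
   Context: For $b\in{}^\omega(\omega+1\setminus2)$: $\prod b=\prod_nb(n)$, $\mathrm{seq}(b)=\bigcup_n\prod_{k<n}b(k)$, $\Sigma_b$ = set of $\sigma:\mathrm{seq}(b)\to\omega$ with $\sigma(s)\in b(|s|)$. A relation sequence for $b$ is $R=\langle R_n\rangle$ with $R_n\subseteq b(n)\times b(n)$ and $\emptyset\ne\{k:kR_nm\}\ne b(n)$ for each $m\in b(n)$. For $f\in\prod b$, $\sigma\in\Sigma_b$: $f\sqsubset^{\mathrm{cp}}_R\sigma$ iff $\exists k\ \forall i\ \exists j\in[i,i+k)\ f(j)R_j\sigma(f\restriction j)$; $f\sqsubset^{\mathrm{pr}}_R\sigma$ iff $\forall^\infty j\ f(j)R_j\sigma(f\restriction j)$. $\mathbf E^{\mathrm{cp}}_{b,R}=\langle\prod b,\Sigma_b,\sqsubset^{\mathrm{cp}}_R\rangle$, $\mathbf E^{\mathrm{pr}}_{b,R}=\langle\prod b,\Sigma_b,\sqsubset^{\mathrm{pr}}_R\rangle$. For a relational system $\mathbf R=\langle X,Y,\sqsubset\rangle$, $\mathfrak b(\mathbf R)$ is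 the least size of $F\subseteq X$ with no $y\in Y$ such that $x\sqsubset y$ for all $x\in F$, and $\mathfrak d(\mathbf R)$ is the least size of $D\subseteq Y$ such that every $x\in X$ satisfies $x\sqsubset y$ for some $y\in D$. $\mathfrak e^{\mathsf{const}}_{b,R}=\mathfrak b(\mathbf E^{\mathrm{cp}}_{b,R})$, $\mathfrak v^{\mathsf{const}}_{b,R}=\mathfrak d(\mathbf E^{\mathrm{cp}}_{b,R})$, $\mathfrak e^{\forall}_{b,R}=\mathfrak b(\mathbf E^{\mathrm{pr}}_{b,R})$, $\mathfrak v^{\forall}_{b,R}=\mathfrak d(\mathbf E^{\mathrm{pr}}_{b,R})$. $\mathbf R\preceq_{\mathrm T}\mathbf R'$ (for $\mathbf R'=\langle X',Y',\sqsubset'\rangle$) means there are $\Psi_-:X\to X'$, $\Psi_+:Y'\to Y$ with $\Psi_-(x)\sqsubset'y'\Rightarrow x\sqsubset\Psi_+(y')$. -}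

module Defs where

open import Data.Nat using (ℕ; zero; suc; _+_; _≤_; _<_)
open import Data.Maybe using (Maybe; just; nothing)
open import Data.List using (List; []; _∷_)
open import Data.Product using (Σ; ∃; ∃-syntax; _×_; _,_; proj₁; proj₂)
open import Data.Unit using (⊤; tt)
open import Relation.Nullary using (¬_)

-- Elements of ω+1 are encoded as Maybe ℕ: 'just m' is the finite ordinal m,
-- 'nothing' is ω.
ω+1 : Set
ω+1 = Maybe ℕ

_∈ₒ_ : ℕ → ω+1 → Set
k ∈ₒ just m  = k < m
k ∈ₒ nothing = ⊤

AtLeast2 : ω+1 → Set
AtLeast2 (just m) = 2 ≤ m
AtLeast2 nothing  = ⊤

IsBound : (ℕ → ω+1) → Set
IsBound b = ∀ n → AtLeast2 (b n)

Prod : (ℕ → ω+1) → Set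
Prod b = Σ (ℕ → ℕ) λ f → ∀ n → f n ∈ₒ b n

FitsFrom : (ℕ → ω+1) → ℕ → List ℕ → Set
FitsFrom b i []       = ⊤
FitsFrom b i (x ∷ xs) = (x ∈ₒ b i) × FitsFrom b (suc i) xs

length : List ℕ → ℕ
length []       = 0
length (_ ∷ xs) = suc (length xs)

Seq : (ℕ → ω+1) → Set
Seq b = Σ (List ℕ) (FitsFrom b 0)

Slalom : (ℕ → ω+1) → Set
Slalom b = Σ (Seq b → ℕ) λ σ → ∀ s → σ s ∈ₒ b (length (proj₁ s))

restrFrom : (ℕ → ℕ) → ℕ → ℕ → List ℕ
restrFrom f i zero    = []
restrFrom f i (suc j) = f i ∷ restrFrom f (suc i) j

restrFrom-fits : (b : ℕ → ω+1) (f : ℕ → ℕ) → (∀ n → f n ∈ₒ b n) →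
                 ∀ i j → FitsFrom b i (restrFrom f i j)
restrFrom-fits b f p i zero    = tt
restrFrom-fits b f p i (suc j) = p i , restrFrom-fits b f p (suc i) j

restr : {b : ℕ → ω+1} → Prod b → ℕ → Seq b
restr {b} (f , p) j = restrFrom f 0 j , restrFrom-fits b f p 0 j

-- A relation sequence: R n k m stands for k R_n m (only its values on b(n)×b(n) matter)
IsRelSeq : (b : ℕ → ω+1) → (ℕ → ℕ → ℕ → Set) → Set
IsRelSeq b R = ∀ n m → m ∈ₒ b n →
  (∃[ k ] (k ∈ₒ b n × R n k m)) × ¬ (∀ k → k ∈ₒ b n → R n k m)

_⊏cp[_]_ : {b : ℕ → ω+1} → Prod b → (ℕ → ℕ → ℕ → Set) → Slalom b → Set
_⊏cp[_]_ {b} f R σ = ∃[ k ] ∀ i → ∃[ j ] (i ≤ j × j < i + k ×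
  R j (proj₁ f j) (proj₁ σ (restr {b} f j)))

_⊏pr[_]_ : {b : ℕ → ω+1} → Prod b → (ℕ → ℕ → ℕ → Set) → Slalom b → Set
_⊏pr[_]_ {b} f R σ = ∃[ N ] ∀ j → N ≤ j → R j (proj₁ f j) (proj₁ σ (restr {b} f j))

record RelSys : Set₁ where
  field
    X   : Set
    Y   : Set
    rel : X → Y → Set
open RelSys public

_≼T_ : RelSys → RelSys → Set
𝐑 ≼T 𝐑' = Σ (X 𝐑 → X 𝐑') λ Ψ₋ → Σ (Y 𝐑' → Y 𝐑) λ Ψ₊ →
  ∀ x y' → rel 𝐑' (Ψ₋ x) y' → rel 𝐑 x (Ψ₊ y')

Ecp : (b : ℕ → ω+1) → (ℕ → ℕ → ℕ → Set) → RelSys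
Ecp b R = record { X = Prod b ; Y = Slalom b ; rel = λ f σ → _⊏cp[_]_ {b} f R σ }

Epr : (b : ℕ → ω+1) → (ℕ → ℕ → ℕ → Set) → RelSys
Epr b R = record { X = Prod b ; Y = Slalom b ; rel = λ f σ → _⊏pr[_]_ {b} f R σ }

Unbounded : (𝐑 : RelSys) {I : Set} → (I → X 𝐑) → Set
Unbounded 𝐑 F = ¬ (Σ (Y 𝐑) λ y → ∀ i → rel 𝐑 (F i) y)

Dominating : (𝐑 : RelSys) {I : Set} → (I → Y 𝐑) → Set
Dominating 𝐑 D = ∀ x → ∃ λ i → rel 𝐑 x (D i)

-- 𝔟(𝐑) ≤ 𝔟(𝐑'): every unbounded family in 𝐑' indexed by I yields one in 𝐑 indexed by I
𝔟≤ : RelSys → RelSys → Set₁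
𝔟≤ 𝐑 𝐑' = (I : Set) (F : I → X 𝐑') → Unbounded 𝐑' F →
           Σ (I → X 𝐑) λ G → Unbounded 𝐑 G

-- 𝔡(𝐑) ≤ 𝔡(𝐑'): every dominating family in 𝐑' indexed by I yields one in 𝐑 indexed by I
𝔡≤ : RelSys → RelSys → Set₁
𝔡≤ 𝐑 𝐑' = (I : Set) (D : I → Y 𝐑') → Dominating 𝐑' D →
           Σ (I → Y 𝐑) λ E → Dominating 𝐑 E

{-# OPTIONS --safe #-}
module Submission where

open import Defs
open import Data.Nat using (ℕ; suc; _+_)
open import Data.Nat.Properties using (m≤m+n; m≤n+m; n<1+n; +-monoʳ-<)
open import Data.Product using (_×_; _,_)

-- The identity maps form the Tukey connection: if f(j) R_j σ(f↾j) holds for all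
-- j ≥ N, then it holds at j = i + N inside every window [i, i + N + 1).

pr⇒cp : {b : ℕ → ω+1} {R : ℕ → ℕ → ℕ → Set} (f : Prod b) (σ : Slalom b) →
  _⊏pr[_]_ {b} f R σ → _⊏cp[_]_ {b} f R σ
pr⇒cp _ _ (N , holds-from-N) = suc N , λ i →
  i + N , m≤m+n i N , +-monoʳ-< i (n<1+n N) , holds-from-N (i + N) (m≤n+m N i)

≼T-from-⊆ : {A B : Set} {_⊏_ _⊏′_ : A → B → Set} → (∀ x y → x ⊏′ y → x ⊏ y) →
  record { X = A ; Y = B ; rel = _⊏_ } ≼T record { X = A ; Y = B ; rel = _⊏′_ }
≼T-from-⊆ ⊏′⇒⊏ = (λ x → x) , (λ y → y) , ⊏′⇒⊏

module _ {𝐑 𝐑′ : RelSys} where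

  ≼T⇒𝔟≥ : 𝐑 ≼T 𝐑′ → 𝔟≤ 𝐑′ 𝐑
  ≼T⇒𝔟≥ (Ψ₋ , Ψ₊ , connect) I F unbounded = (λ i → Ψ₋ (F i)) ,
    λ (y′ , bounds) → unbounded (Ψ₊ y′ , λ i → connect (F i) y′ (bounds i))

  ≼T⇒𝔡≤ : 𝐑 ≼T 𝐑′ → 𝔡≤ 𝐑 𝐑′
  ≼T⇒𝔡≤ (Ψ₋ , Ψ₊ , connect) I D dominating = (λ i → Ψ₊ (D i)) , λ x →
    let (i , Ψ₋x⊏′Dᵢ) = dominating (Ψ₋ x) in i , connect x (D i) Ψ₋x⊏′Dᵢ

lemma4p2 : (b : ℕ → ω+1) → IsBound b → (R : ℕ → ℕ → ℕ → Set) → IsRelSeq b R →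
    (Ecp b R ≼T Epr b R) × 𝔟≤ (Epr b R) (Ecp b R) × 𝔡≤ (Ecp b R) (Epr b R)
lemma4p2 b _ R _ =
  Ecp≼Epr , ≼T⇒𝔟≥ {Ecp b R} {Epr b R} Ecp≼Epr , ≼T⇒𝔡≤ {Ecp b R} {Epr b R} Ecp≼Epr
  where
  Ecp≼Epr : Ecp b R ≼T Epr b R
  Ecp≼Epr = ≼T-from-⊆ (pr⇒cp {b} {R})
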